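{- Let $n$ be a positive integer such that $2^{2^n}+1$ is prime. Then the following system in the variables $x_1,\ldots,x_{n+6}$: \[ \begin{array}{rcl} x_i \cdot x_i &=& x_{i+1} \quad \text{for every } i \in \{1,\ldots,n\}, \\ x_{n+2} &=& 1, \\ x_{1}+x_{n+2} &=& x_{n+3}, \\ x_{n+3}+x_{n+2} &=& x_{n+4}, \\ x_{n+1}+x_{n+2} &=& x_{n+5}, \\ x_{n+4} \cdot x_{n+6} &=& x_{n+5} \end{array} \] has a unique solution $(a_1,\ldots,a_{n+6})$ in non-negative integers. The numbers $a_1,\ldots,a_{n+6}$ are positive and $\max(a_1,\ldots,a_{n+6}) = a_{n+5} = \left(2^{2^n}-1\right)^{2^n}+1$. -}

module Defs where

open import Data.Nat using (ℕ; zero; suc; _+_; _*_; _≤_; _<?_)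
open import Data.Fin using (Fin; fromℕ<)
open import Relation.Nullary using (yes; no)
open import Relation.Binary.PropositionalEquality using (_≡_)

-- An assignment of non-negative integers to the variables x₁,…,x_{n+6}:
-- variable x_i (1-indexed) is stored at position i - 1 of Fin (n + 6).
Assignment : ℕ → Set
Assignment n = Fin (n + 6) → ℕ

-- x a i  =  the value of x_i (1-indexed).  Out-of-range indices
-- (i = 0 or i > n + 6) give 0; they are never used below.
x : ∀ {n} → Assignment n → ℕ → ℕ
x a zero = 0
x {n} a (suc j) with j <? n + 6
... | yes j< = a (fromℕ< j<)
... | no _   = 0

record System (n : ℕ) (a : Assignment n) : Set where
  field
    squares : ∀ i → 1 ≤ i → i ≤ n → x a i * x a i ≡ x a (suc i)
    eq-one  : x a (n + 2) ≡ 1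
    eq-n3   : x a 1 + x a (n + 2) ≡ x a (n + 3)
    eq-n4   : x a (n + 3) + x a (n + 2) ≡ x a (n + 4)
    eq-n5   : x a (n + 1) + x a (n + 2) ≡ x a (n + 5)
    eq-n6   : x a (n + 4) * x a (n + 6) ≡ x a (n + 5)

-- Write c for the value of x₁. The squaring equations give x_{j+1} = c^(2^j) for j ≤ n, and
-- the linear ones give x_{n+2}, …, x_{n+5} = 1, c + 1, c + 2, c^(2^n) + 1, so the last equation
-- says that c + 2 divides c^(2^n) + 1. Since c ≡ -2 modulo c + 2 and 2^n is even, c + 2 then
-- divides the Fermat prime 2^(2^n) + 1, and being at least 2 it equals it. This pins down c and
-- hence every xᵢ; conversely c = 2^(2^n) - 1 does give a solution.
module Submission where

open import Defs
open import Data.Nat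
  using (ℕ; zero; suc; _+_; _*_; _^_; _∸_; _≤_; _<_; z≤n; s≤s; z<s; s<s; s<s⁻¹; _≤?_; _<?_; NonZero; >-nonZero)
open import Data.Nat.Properties
open import Data.Nat.DivMod using (_%_; _/_; [m+kn]%n≡m%n; %-distribˡ-+; %-distribˡ-*; n%n≡0; m*[n/m]≡n)
open import Data.Nat.Divisibility using (_∣_; divides; m%n≡0⇒n∣m; n∣m⇒m%n≡0; ∣⇒≤)
open import Data.Nat.Primality using (Prime; prime⇒irreducible)
open import Data.Nat.Solver using (module +-*-Solver)
open import Data.Fin using (toℕ)
open import Data.Fin.Properties using (toℕ-fromℕ<; fromℕ<-toℕ; toℕ<n)
open import Data.Product using (Σ; _×_; _,_)
open import Data.Sum using (inj₁; inj₂)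
open import Function using (_∘_)
open import Relation.Nullary using (yes; no; contradiction)
open import Relation.Binary.PropositionalEquality
open ≡-Reasoning

%-cong-+ʳ : ∀ {a b} k d .{{_ : NonZero d}} → a % d ≡ b % d → (a + k) % d ≡ (b + k) % d
%-cong-+ʳ {a} {b} k d a≡b = begin
  (a + k) % d           ≡⟨ %-distribˡ-+ a k d ⟩
  (a % d + k % d) % d   ≡⟨ cong (λ u → (u + k % d) % d) a≡b ⟩
  (b % d + k % d) % d   ≡⟨ %-distribˡ-+ b k d ⟨
  (b + k) % d           ∎

%-cong-^ : ∀ {a b} K d .{{_ : NonZero d}} → a % d ≡ b % d → (a ^ K) % d ≡ (b ^ K) % d
%-cong-^ zero d a≡b = refl
%-cong-^ {a} {b} (suc K) d a≡b = begin
  (a * a ^ K) % d                 ≡⟨ %-distribˡ-* a (a ^ K) d ⟩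
  ((a % d) * ((a ^ K) % d)) % d   ≡⟨ cong₂ (λ u v → (u * v) % d) a≡b (%-cong-^ K d a≡b) ⟩
  ((b % d) * ((b ^ K) % d)) % d   ≡⟨ %-distribˡ-* b (b ^ K) d ⟨
  (b * b ^ K) % d                 ∎

-- c ≡ -2 modulo 2 + c, in the subtraction-free form c² + 2(2 + c) = 2² + c(2 + c).
square-mod-2+ : ∀ c → (c ^ 2) % (2 + c) ≡ (2 ^ 2) % (2 + c)
square-mod-2+ c = begin
  (c ^ 2) % (2 + c)                 ≡⟨ [m+kn]%n≡m%n (c ^ 2) 2 (2 + c) ⟨
  (c ^ 2 + 2 * (2 + c)) % (2 + c)   ≡⟨ cong (_% (2 + c)) (shift c) ⟩
  (2 ^ 2 + c * (2 + c)) % (2 + c)   ≡⟨ [m+kn]%n≡m%n (2 ^ 2) c (2 + c) ⟩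
  (2 ^ 2) % (2 + c)                 ∎
  where
  open +-*-Solver
  shift : ∀ c → c ^ 2 + 2 * (2 + c) ≡ 2 ^ 2 + c * (2 + c)
  shift = solve 1 (λ c → c :^ 2 :+ con 2 :* (con 2 :+ c) := con 2 :^ 2 :+ c :* (con 2 :+ c)) refl

even-power+1-mod-2+ : ∀ c K → (c ^ (2 * K) + 1) % (2 + c) ≡ (2 ^ (2 * K) + 1) % (2 + c)
even-power+1-mod-2+ c K = %-cong-+ʳ {c ^ (2 * K)} {2 ^ (2 * K)} 1 (2 + c) (begin
  (c ^ (2 * K)) % (2 + c)   ≡⟨ cong (_% (2 + c)) (^-*-assoc c 2 K) ⟨
  ((c ^ 2) ^ K) % (2 + c)   ≡⟨ %-cong-^ K (2 + c) (square-mod-2+ c) ⟩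
  ((2 ^ 2) ^ K) % (2 + c)   ≡⟨ cong (_% (2 + c)) (^-*-assoc 2 2 K) ⟩
  (2 ^ (2 * K)) % (2 + c)   ∎)

2+c∣c^[2K]+1⇒2+c∣2^[2K]+1 : ∀ c K → 2 + c ∣ c ^ (2 * K) + 1 → 2 + c ∣ 2 ^ (2 * K) + 1
2+c∣c^[2K]+1⇒2+c∣2^[2K]+1 c K 2+c∣ = m%n≡0⇒n∣m _ (2 + c)
  (trans (sym (even-power+1-mod-2+ c K)) (n∣m⇒m%n≡0 _ (2 + c) 2+c∣))

2+c∣prime⇒2+c≡prime : ∀ {p} c → Prime p → 2 + c ∣ p → 2 + c ≡ p
2+c∣prime⇒2+c≡prime c p-prime 2+c∣p with prime⇒irreducible p-prime 2+c∣p
... | inj₁ ()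
... | inj₂ 2+c≡p = 2+c≡p

divisor-of-Fermat-prime : ∀ c K → Prime (2 ^ (2 * K) + 1) →
                          2 + c ∣ c ^ (2 * K) + 1 → c ≡ 2 ^ (2 * K) ∸ 1
divisor-of-Fermat-prime c K p-prime 2+c∣ = cong (_∸ 2)
  (trans (2+c∣prime⇒2+c≡prime c p-prime (2+c∣c^[2K]+1⇒2+c∣2^[2K]+1 c K 2+c∣))
         (+-comm (2 ^ (2 * K)) 1))

2^[2K]∸1-divisibility : ∀ K → let c = 2 ^ (2 * K) ∸ 1 in 2 + c ∣ c ^ (2 * K) + 1
2^[2K]∸1-divisibility K = m%n≡0⇒n∣m _ (2 + c) (begin
  (c ^ (2 * K) + 1) % (2 + c)   ≡⟨ even-power+1-mod-2+ c K ⟩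
  (2 ^ (2 * K) + 1) % (2 + c)   ≡⟨ cong (_% (2 + c)) 2+c≡ ⟨
  (2 + c) % (2 + c)             ≡⟨ n%n≡0 (2 + c) ⟩
  0                             ∎)
  where
  c = 2 ^ (2 * K) ∸ 1
  2+c≡ : 2 + c ≡ 2 ^ (2 * K) + 1
  2+c≡ = trans (cong suc (m+[n∸m]≡n (m^n>0 2 (2 * K)))) (+-comm 1 (2 ^ (2 * K)))

^-square : ∀ c j → c ^ (2 ^ j) * c ^ (2 ^ j) ≡ c ^ (2 ^ suc j)
^-square c j = begin
  c ^ m * c ^ m         ≡⟨ cong (λ k → c ^ m * c ^ k) (+-identityʳ m) ⟨
  c ^ m * c ^ (m + 0)   ≡⟨ ^-distribˡ-+-* c m (m + 0) ⟨
  c ^ (2 ^ suc j)       ∎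
  where m = 2 ^ j

iterated-squares : ∀ (g : ℕ → ℕ) n → (∀ j → j < n → g j * g j ≡ g (suc j)) →
                   ∀ j → j ≤ n → g j ≡ g 0 ^ (2 ^ j)
iterated-squares g n squares zero _ = sym (*-identityʳ (g 0))
iterated-squares g n squares (suc j) j<n = begin
  g (suc j)                       ≡⟨ squares j j<n ⟨
  g j * g j                       ≡⟨ cong₂ _*_ previous previous ⟩
  g 0 ^ (2 ^ j) * g 0 ^ (2 ^ j)   ≡⟨ ^-square (g 0) j ⟩
  g 0 ^ (2 ^ suc j)               ∎
  where previous = iterated-squares g n squares j (<⇒≤ j<n)

m+1+1≡2+m : ∀ m → m + 1 + 1 ≡ 2 + m
m+1+1≡2+m m = trans (+-assoc m 1 1) (+-comm m 2)

quotient-positive : ∀ d {q m} → d * q ≡ m + 1 → 0 < q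
quotient-positive d {zero} {m} d*0≡m+1 =
  contradiction (trans (sym (*-zeroʳ d)) (trans d*0≡m+1 (+-comm m 1))) 0≢1+n
quotient-positive d {suc _} _ = z<s

data Position (n : ℕ) : ℕ → Set where
  power : ∀ {j} → j ≤ n → Position n j
  tail  : ∀ r → Position n (n + suc r)

position : ∀ n j → Position n j
position zero    zero    = power z≤n
position zero    (suc j) = tail j
position (suc n) zero    = power z≤n
position (suc n) (suc j) with position n j
... | power j≤n = power (s≤s j≤n)
... | tail r    = tail r

tail-bound : ∀ n r → n + suc r < n + 6 → r < 5
tail-bound n r = s<s⁻¹ ∘ +-cancelˡ-< n (suc r) 6

-- tailValue n c q r is the forced value of x_{n+2+r} when x₁ = c and x_{n+6} = q. Arguments
-- r ≥ 5 are never read; the value 1 there keeps positivity and the bound unconditional.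
tailValue : (n c q : ℕ) → ℕ → ℕ
tailValue n c q 0 = 1
tailValue n c q 1 = c + 1
tailValue n c q 2 = 2 + c
tailValue n c q 3 = c ^ (2 ^ n) + 1
tailValue n c q 4 = q
tailValue n c q _ = 1

-- canonical n c q j is the forced value of x_{j+1}.
canonical : (n c q : ℕ) → ℕ → ℕ
canonical n c q j with j ≤? n
... | yes _ = c ^ (2 ^ j)
... | no _  = tailValue n c q (j ∸ suc n)

canonical-power : ∀ {n c q j} → j ≤ n → canonical n c q j ≡ c ^ (2 ^ j)
canonical-power {n} {j = j} j≤n with j ≤? n
... | yes _  = refl
... | no j≰n = contradiction j≤n j≰n

canonical-tail : ∀ {n c q} r → canonical n c q (n + suc r) ≡ tailValue n c q r
canonical-tail {n} {c} {q} r with n + suc r ≤? n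
... | yes n+1+r≤n = contradiction n+1+r≤n (<⇒≱ (m<m+n n z<s))
... | no _        = cong (tailValue n c q) (trans (cong (_∸ suc n) (+-suc n r)) (m+n∸m≡n (suc n) r))

module _ {n} {b : Assignment n} (S : System n b) where
  open System S

  system⇒powers : ∀ j → j ≤ n → x b (suc j) ≡ x b 1 ^ (2 ^ j)
  system⇒powers = iterated-squares (x b ∘ suc) n (λ j j<n → squares (suc j) (s≤s z≤n) j<n)

  system⇒tail : ∀ r → r < 5 → x b (n + suc (suc r)) ≡ tailValue n (x b 1) (x b (n + 6)) r
  system⇒tail 0 _ = eq-one
  system⇒tail 1 _ = trans (sym eq-n3) (cong (x b 1 +_) eq-one)
  system⇒tail 2 _ = begin
    x b (n + 4)                 ≡⟨ eq-n4 ⟨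
    x b (n + 3) + x b (n + 2)   ≡⟨ cong₂ _+_ (system⇒tail 1 (s<s z<s)) eq-one ⟩
    x b 1 + 1 + 1               ≡⟨ m+1+1≡2+m (x b 1) ⟩
    2 + x b 1                   ∎
  system⇒tail 3 _ = begin
    x b (n + 5)                 ≡⟨ eq-n5 ⟨
    x b (n + 1) + x b (n + 2)   ≡⟨ cong₂ _+_ (cong (x b) (+-comm n 1)) eq-one ⟩
    x b (suc n) + 1             ≡⟨ cong (_+ 1) (system⇒powers n ≤-refl) ⟩
    x b 1 ^ (2 ^ n) + 1         ∎
  system⇒tail 4 _ = refl
  system⇒tail (suc (suc (suc (suc (suc r))))) (s<s (s<s (s<s (s<s (s<s ())))))

  system⇒canonical : ∀ j → j < n + 6 → x b (suc j) ≡ canonical n (x b 1) (x b (n + 6)) j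
  system⇒canonical j j<n+6 with position n j
  ... | power j≤n = trans (system⇒powers j j≤n) (sym (canonical-power j≤n))
  ... | tail r    = begin
    x b (suc (n + suc r))                         ≡⟨ cong (x b) (+-suc n (suc r)) ⟨
    x b (n + suc (suc r))                         ≡⟨ system⇒tail r (tail-bound n r j<n+6) ⟩
    tailValue n (x b 1) (x b (n + 6)) r           ≡⟨ canonical-tail r ⟨
    canonical n (x b 1) (x b (n + 6)) (n + suc r) ∎

  system⇒quotient : (2 + x b 1) * x b (n + 6) ≡ x b 1 ^ (2 ^ n) + 1
  system⇒quotient = begin
    (2 + x b 1) * x b (n + 6)   ≡⟨ cong (_* x b (n + 6)) (system⇒tail 2 (s<s (s<s z<s))) ⟨
    x b (n + 4) * x b (n + 6)   ≡⟨ eq-n6 ⟩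
    x b (n + 5)                 ≡⟨ system⇒tail 3 (s<s (s<s (s<s z<s))) ⟩
    x b 1 ^ (2 ^ n) + 1         ∎

x-toℕ : ∀ {n} (b : Assignment n) k → x b (suc (toℕ k)) ≡ b k
x-toℕ {n} b k with toℕ k <? n + 6
... | yes k<n+6 = cong b (fromℕ<-toℕ k k<n+6)
... | no k≮n+6  = contradiction (toℕ<n k) k≮n+6

systems-agree : ∀ {n} {a b : Assignment n} → System n a → System n b → x a 1 ≡ x b 1 → ∀ k → a k ≡ b k
systems-agree {n} {a} {b} Sa Sb c≡ k = begin
  a k                                         ≡⟨ x-toℕ a k ⟨
  x a (suc (toℕ k))                           ≡⟨ system⇒canonical Sa (toℕ k) (toℕ<n k) ⟩
  canonical n (x a 1) (x a (n + 6)) (toℕ k)   ≡⟨ cong₂ (λ c q → canonical n c q (toℕ k)) c≡ q≡ ⟩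
  canonical n (x b 1) (x b (n + 6)) (toℕ k)   ≡⟨ system⇒canonical Sb (toℕ k) (toℕ<n k) ⟨
  x b (suc (toℕ k))                           ≡⟨ x-toℕ b k ⟩
  b k                                         ∎
  where
  q≡ : x a (n + 6) ≡ x b (n + 6)
  q≡ = *-cancelˡ-≡ _ _ (2 + x a 1) (begin
    (2 + x a 1) * x a (n + 6)   ≡⟨ system⇒quotient Sa ⟩
    x a 1 ^ (2 ^ n) + 1         ≡⟨ cong (λ c → c ^ (2 ^ n) + 1) c≡ ⟩
    x b 1 ^ (2 ^ n) + 1         ≡⟨ system⇒quotient Sb ⟨
    (2 + x b 1) * x b (n + 6)   ≡⟨ cong (λ c → (2 + c) * x b (n + 6)) c≡ ⟨
    (2 + x a 1) * x b (n + 6)   ∎)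

system⇒first : ∀ {n} {b : Assignment (suc n)} → Prime (2 ^ (2 ^ suc n) + 1) →
               System (suc n) b → x {suc n} b 1 ≡ 2 ^ (2 ^ suc n) ∸ 1
system⇒first {n} {b} p-prime S = divisor-of-Fermat-prime c (2 ^ n) p-prime
  (divides q (trans (sym (system⇒quotient S)) (*-comm (2 + c) q)))
  where
  c = x {suc n} b 1
  q = x {suc n} b (suc n + 6)

solution : (n c q : ℕ) → Assignment n
solution n c q = canonical n c q ∘ toℕ

module Solution (n c q : ℕ) where
  private
    a = solution n c q

  x-solution : ∀ j → j < n + 6 → x a (suc j) ≡ canonical n c q j
  x-solution j j<n+6 with j <? n + 6
  ... | yes j<n+6′ = cong (canonical n c q) (toℕ-fromℕ< j<n+6′)
  ... | no j≮n+6   = contradiction j<n+6 j≮n+6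

  solution-power : ∀ j → j ≤ n → x a (suc j) ≡ c ^ (2 ^ j)
  solution-power j j≤n = trans (x-solution j (≤-<-trans j≤n (m<m+n n z<s))) (canonical-power j≤n)

  solution-tail : ∀ r → r < 5 → x a (n + suc (suc r)) ≡ tailValue n c q r
  solution-tail r r<5 = begin
    x a (n + suc (suc r))         ≡⟨ cong (x a) (+-suc n (suc r)) ⟩
    x a (suc (n + suc r))         ≡⟨ x-solution (n + suc r) (+-monoʳ-< n (s<s r<5)) ⟩
    canonical n c q (n + suc r)   ≡⟨ canonical-tail r ⟩
    tailValue n c q r             ∎

  module _ (quotient : (2 + c) * q ≡ c ^ (2 ^ n) + 1) where

    solution-solves : System n a
    solution-solves = record
      { squares = λ { (suc j) _ j<n → begin
          x a (suc j) * x a (suc j)   ≡⟨ cong (λ v → v * v) (solution-power j (<⇒≤ j<n)) ⟩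
          c ^ (2 ^ j) * c ^ (2 ^ j)   ≡⟨ ^-square c j ⟩
          c ^ (2 ^ suc j)             ≡⟨ solution-power (suc j) j<n ⟨
          x a (suc (suc j))           ∎ }
      ; eq-one = solution-tail 0 z<s
      ; eq-n3  = trans (cong₂ _+_ first (solution-tail 0 z<s)) (sym (solution-tail 1 (s<s z<s)))
      ; eq-n4  = trans (cong₂ _+_ (solution-tail 1 (s<s z<s)) (solution-tail 0 z<s))
                       (trans (m+1+1≡2+m c) (sym (solution-tail 2 (s<s (s<s z<s)))))
      ; eq-n5  = trans (cong₂ _+_ top (solution-tail 0 z<s)) (sym (solution-tail 3 (s<s (s<s (s<s z<s)))))
      ; eq-n6  = trans (cong₂ _*_ (solution-tail 2 (s<s (s<s z<s))) (solution-tail 4 (s<s (s<s (s<s (s<s z<s))))))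
                       (trans quotient (sym (solution-tail 3 (s<s (s<s (s<s z<s))))))
      }
      where
      first : x a 1 ≡ c
      first = trans (solution-power 0 z≤n) (*-identityʳ c)
      top : x a (n + 1) ≡ c ^ (2 ^ n)
      top = trans (cong (x a) (+-comm n 1)) (solution-power n ≤-refl)

    module _ (c>0 : 0 < c) where

      canonical-positive : ∀ j → 0 < canonical n c q j
      canonical-positive j with j ≤? n
      ... | yes _ = m^n>0 c {{>-nonZero c>0}} (2 ^ j)
      ... | no _  = tail-positive (j ∸ suc n)
        where
        tail-positive : ∀ r → 0 < tailValue n c q r
        tail-positive 0 = z<s
        tail-positive 1 = m≤n+m 1 c
        tail-positive 2 = z<s
        tail-positive 3 = m≤n+m 1 (c ^ (2 ^ n))
        tail-positive 4 = quotient-positive (2 + c) quotient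
        tail-positive (suc (suc (suc (suc (suc _))))) = z<s

      canonical-bounded : ∀ j → canonical n c q j ≤ c ^ (2 ^ n) + 1
      canonical-bounded j with j ≤? n
      ... | yes j≤n = ≤-trans (^-monoʳ-≤ c {{>-nonZero c>0}} (^-monoʳ-≤ 2 j≤n)) (m≤m+n _ 1)
      ... | no _    = tail-bounded (j ∸ suc n)
        where
        instance
          top-nonZero : NonZero (c ^ (2 ^ n) + 1)
          top-nonZero = >-nonZero (m≤n+m 1 (c ^ (2 ^ n)))
        2+c≤top : 2 + c ≤ c ^ (2 ^ n) + 1
        2+c≤top = ∣⇒≤ (divides q (trans (sym quotient) (*-comm (2 + c) q)))
        tail-bounded : ∀ r → tailValue n c q r ≤ c ^ (2 ^ n) + 1
        tail-bounded 0 = m≤n+m 1 _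
        tail-bounded 1 = ≤-trans (≤-reflexive (+-comm c 1)) (≤-trans (n≤1+n (suc c)) 2+c≤top)
        tail-bounded 2 = 2+c≤top
        tail-bounded 3 = ≤-refl
        tail-bounded 4 = subst (q ≤_) (trans (*-comm q (2 + c)) quotient) (m≤m*n q (2 + c))
        tail-bounded (suc (suc (suc (suc (suc _))))) = m≤n+m 1 _

      solution-maximum : ∀ i → 1 ≤ i → i ≤ n + 6 → x a i ≤ x a (n + 5)
      solution-maximum (suc j) _ j<n+6 =
        subst₂ _≤_ (sym (x-solution j j<n+6)) (sym (solution-tail 3 (s<s (s<s (s<s z<s)))))
          (canonical-bounded j)

theorem3 : (n : ℕ) → 1 ≤ n → Prime (2 ^ (2 ^ n) + 1) →
    Σ (Assignment n) λ a →
    System n a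
    × (∀ (b : Assignment n) → System n b → ∀ k → b k ≡ a k)
    × (∀ k → 0 < a k)
    × (∀ i → 1 ≤ i → i ≤ n + 6 → x a i ≤ x a (n + 5))
    × (x a (n + 5) ≡ (2 ^ (2 ^ n) ∸ 1) ^ (2 ^ n) + 1)
theorem3 (suc n) _ p-prime =
  a , solves , unique , canonical-positive quotient c>0 ∘ toℕ , solution-maximum quotient c>0
    , solution-tail 3 (s<s (s<s (s<s z<s)))
  where
  c = 2 ^ (2 ^ suc n) ∸ 1
  c>0 : 0 < c
  c>0 = ∸-monoˡ-≤ 1 (^-monoʳ-≤ 2 (m^n>0 2 (suc n)))
  q = (c ^ (2 ^ suc n) + 1) / (2 + c)
  quotient : (2 + c) * q ≡ c ^ (2 ^ suc n) + 1
  quotient = m*[n/m]≡n (2^[2K]∸1-divisibility (2 ^ n))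
  open Solution (suc n) c q
  a = solution (suc n) c q
  solves : System (suc n) a
  solves = solution-solves quotient
  unique : ∀ b → System (suc n) b → ∀ k → b k ≡ a k
  unique b Sb = systems-agree Sb solves
    (trans (system⇒first p-prime Sb) (sym (system⇒first p-prime solves)))
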